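{- Let the atomic propositions of multi-agent epistemic logic $\mathsf{KB4}$ (with knowledge operators $K_a$, $a\in\mathcal A$) be the set $AP_e$ of environment atomic propositions of $\mathsf{2CH}$, and define the translation $t$ from $\mathsf{KB4}$-formulas to world formulas of $\mathsf{2CH}$ by $t(p)=p$, $t(\neg\Phi)=\neg t(\Phi)$, $t(\Phi\wedge\Psi)=t(\Phi)\wedge t(\Psi)$, $t(K_a\Phi)=[a]\Box_a t(\Phi)$. Then for every $\mathsf{KB4}$-formula $\Phi$: $\Phi$ is derivable in $\mathsf{KB4}+\mathsf{NE}$ if and only if $\vdash_e t(\Phi)$.
   Context: $\mathsf{KB4}+\mathsf{NE}$: the normal multimodal logic over a finite agent set $\mathcal A$ with operators $K_a$, axiomatized by all propositional tautologies, modus ponens, necessitation for each $K_a$, axiom $\mathsf K$: $K_a(\Phi\to\Psi)\to(K_a\Phi\to K_a\Psi)$, axiom $\mathsf B$: $\Phi\to K_a\neg K_a\neg\Phi$, axiom $\mathsf 4$: $K_a\Phi\to K_aK_a\Phi$, and axiom $\mathsf{NE}$: $\bigvee_{a\in\mathcal A}\neg K_a\bot$. Logic $\mathsf{2CH}$. Sets $AP_a$ ($a\in\mathcal A$) are arbitrary. Agent formulas of sort $a$: $\varphi ::= p_a \mid \neg\varphi \mid \varphi\wedge\psi \mid \Diamond_a\Phi$ ($p_a\in AP_a$, $\Phi$ a world formula). World formulas: $\Phi ::= p_e \mid \neg\Phi \mid \Phi\wedge\Psi \mid \langle a\rangle\varphi$ ($p_e\in AP_e$, $\varphi$ of sort $a$).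 $\Box_a\Phi:=\neg\Diamond_a\neg\Phi$, $[a]\varphi:=\neg\langle a\rangle\neg\varphi$, other connectives as usual abbreviations. Derivability $\vdash_a,\vdash_e$: least relations containing all propositional tautology instances at each sort, closed under modus ponens at each sort, and under: from $\vdash_e\Phi$ infer $\vdash_a\Box_a\Phi$; from $\vdash_a\varphi$ infer $\vdash_e[a]\varphi$; from $\vdash_e\Phi\to\Psi$ infer $\vdash_a\Diamond_a\Phi\to\Diamond_a\Psi$ and $\vdash_a\Box_a\Phi\to\Box_a\Psi$; from $\vdash_a\varphi\to\psi$ infer $\vdash_e\langle a\rangle\varphi\to\langle a\rangle\psi$ and $\vdash_e[a]\varphi\to[a]\psi$; $\vdash_e\Phi\to[a]\psi$ iff $\vdash_a\Diamond_a\Phi\to\psi$; $\vdash_a\varphi\to\Box_a\Psi$ iff $\vdash_e\langle a\rangle\varphi\to\Psi$; and with axioms $\vdash_a\varphi\to\Diamond_a\langle a\rangle\varphi$, $\vdash_a\Diamond_a\langle a\rangle\varphi\to\varphi$, $\vdash_e\bigvee_{a\in\mathcal A}\langle a\rangle\top$. -}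

module Defs where

open import Data.Nat using (ℕ)
open import Data.Fin using (Fin)
open import Data.Bool using (Bool; true; false; not; _∧_)
open import Data.List using (List; []; _∷_; foldr; map)
open import Data.List using (allFin)
open import Relation.Binary.PropositionalEquality using (_≡_)
open import Data.Product using (Σ; _,_)

data PForm : Set where
  var  : ℕ → PForm
  pfalse : PForm
  pneg : PForm → PForm
  pand : PForm → PForm → PForm

evalP : (ℕ → Bool) → PForm → Bool
evalP v (var i)    = v i
evalP v pfalse     = false
evalP v (pneg P)   = not (evalP v P)
evalP v (pand P Q) = evalP v P ∧ evalP v Q

Tautology : PForm → Set
Tautology P = (v : ℕ → Bool) → evalP v P ≡ true

instP : {F : Set} → F → (F → F) → (F → F → F) → (ℕ → F) → PForm → F
instP bot neg and σ (var i)    = σ i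
instP bot neg and σ pfalse     = bot
instP bot neg and σ (pneg P)   = neg (instP bot neg and σ P)
instP bot neg and σ (pand P Q) = and (instP bot neg and σ P) (instP bot neg and σ Q)

TautInstance : {F : Set} → F → (F → F) → (F → F → F) → F → Set
TautInstance {F} bot neg and φ =
  Σ PForm (λ P → Σ (ℕ → F) (λ σ → Σ (Tautology P) (λ _ → instP bot neg and σ P ≡ φ)))

module Logic (n : ℕ) (APa : Fin n → Set) (APe : Set) where

  data Fm : Set where
    atom : APe → Fm
    ⊥k   : Fm
    ¬k_  : Fm → Fm
    _∧k_ : Fm → Fm → Fm
    K    : Fin n → Fm → Fm

  _⇒k_ : Fm → Fm → Fm
  φ ⇒k ψ = ¬k (φ ∧k (¬k ψ))

  _∨k_ : Fm → Fm → Fm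
  φ ∨k ψ = ¬k ((¬k φ) ∧k (¬k ψ))

  NEk : Fm
  NEk = foldr _∨k_ ⊥k (map (λ a → ¬k (K a ⊥k)) (allFin n))

  data ⊢KB4NE : Fm → Set where
    taut : ∀ {φ} → TautInstance ⊥k ¬k_ _∧k_ φ → ⊢KB4NE φ
    mp   : ∀ {φ ψ} → ⊢KB4NE (φ ⇒k ψ) → ⊢KB4NE φ → ⊢KB4NE ψ
    nec  : ∀ {a φ} → ⊢KB4NE φ → ⊢KB4NE (K a φ)
    axK  : ∀ {a φ ψ} → ⊢KB4NE (K a (φ ⇒k ψ) ⇒k (K a φ ⇒k K a ψ))
    axB  : ∀ {a φ} → ⊢KB4NE (φ ⇒k K a (¬k (K a (¬k φ))))
    ax4  : ∀ {a φ} → ⊢KB4NE (K a φ ⇒k K a (K a φ))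
    axNE : ⊢KB4NE NEk

  mutual
    data AForm (a : Fin n) : Set where
      pa   : APa a → AForm a
      ⊥a   : AForm a
      ¬a_  : AForm a → AForm a
      _∧a_ : AForm a → AForm a → AForm a
      ◇    : WForm → AForm a

    data WForm : Set where
      pe   : APe → WForm
      ⊥e   : WForm
      ¬e_  : WForm → WForm
      _∧e_ : WForm → WForm → WForm
      ⟨_⟩_ : (a : Fin n) → AForm a → WForm

  _⇒a_ : ∀ {a} → AForm a → AForm a → AForm a
  φ ⇒a ψ = ¬a (φ ∧a (¬a ψ))

  _⇒e_ : WForm → WForm → WForm
  Φ ⇒e Ψ = ¬e (Φ ∧e (¬e Ψ))

  _∨e_ : WForm → WForm → WForm
  Φ ∨e Ψ = ¬e ((¬e Φ) ∧e (¬e Ψ))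

  ⊤e : WForm
  ⊤e = ¬e ⊥e

  ⊤a : ∀ {a} → AForm a
  ⊤a = ¬a ⊥a

  □ : ∀ {a} → WForm → AForm a
  □ Φ = ¬a (◇ (¬e Φ))

  [_]_ : (a : Fin n) → AForm a → WForm
  [ a ] φ = ¬e (⟨ a ⟩ (¬a φ))

  NEe : WForm
  NEe = foldr _∨e_ ⊥e (map (λ a → ⟨ a ⟩ ⊤a) (allFin n))

  data ⊢a : (a : Fin n) → AForm a → Set
  data ⊢e : WForm → Set

  data ⊢a where
    tautA  : ∀ {a φ} → TautInstance ⊥a ¬a_ _∧a_ φ → ⊢a a φ
    mpA    : ∀ {a φ ψ} → ⊢a a (φ ⇒a ψ) → ⊢a a φ → ⊢a a ψ
    nec□   : ∀ {a Φ} → ⊢e Φ → ⊢a a (□ Φ)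
    mono◇  : ∀ {a Φ Ψ} → ⊢e (Φ ⇒e Ψ) → ⊢a a (◇ Φ ⇒a ◇ Ψ)
    mono□  : ∀ {a Φ Ψ} → ⊢e (Φ ⇒e Ψ) → ⊢a a (□ Φ ⇒a □ Ψ)
    adj1   : ∀ {a Φ ψ} → ⊢e (Φ ⇒e ([ a ] ψ)) → ⊢a a (◇ Φ ⇒a ψ)
    adj2   : ∀ {a φ Ψ} → ⊢e ((⟨ a ⟩ φ) ⇒e Ψ) → ⊢a a (φ ⇒a □ Ψ)
    unit   : ∀ {a φ} → ⊢a a (φ ⇒a ◇ (⟨ a ⟩ φ))
    counit : ∀ {a φ} → ⊢a a (◇ (⟨ a ⟩ φ) ⇒a φ)

  data ⊢e where
    tautE  : ∀ {Φ} → TautInstance ⊥e ¬e_ _∧e_ Φ → ⊢e Φ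
    mpE    : ∀ {Φ Ψ} → ⊢e (Φ ⇒e Ψ) → ⊢e Φ → ⊢e Ψ
    nec[]  : ∀ {a φ} → ⊢a a φ → ⊢e ([ a ] φ)
    mono⟨⟩ : ∀ {a φ ψ} → ⊢a a (φ ⇒a ψ) → ⊢e ((⟨ a ⟩ φ) ⇒e (⟨ a ⟩ ψ))
    mono[] : ∀ {a φ ψ} → ⊢a a (φ ⇒a ψ) → ⊢e (([ a ] φ) ⇒e ([ a ] ψ))
    adj1'  : ∀ {a Φ ψ} → ⊢a a (◇ Φ ⇒a ψ) → ⊢e (Φ ⇒e ([ a ] ψ))
    adj2'  : ∀ {a φ Ψ} → ⊢a a (φ ⇒a □ Ψ) → ⊢e ((⟨ a ⟩ φ) ⇒e Ψ)
    axNEe  : ⊢e NEe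

  t : Fm → WForm
  t (atom p) = pe p
  t ⊥k       = ⊥e
  t (¬k Φ)   = ¬e (t Φ)
  t (Φ ∧k Ψ) = t Φ ∧e t Ψ
  t (K a Φ)  = [ a ] (□ (t Φ))

-- Soundness: [a]□_a is a normal modality, and the adjunctions ◇_a ⊣ [a] and ⟨a⟩ ⊣ □_a with
-- their (co)units yield B and 4 for it; NE is the 2CH axiom ⋁_a ⟨a⟩⊤.  Completeness: translate
-- back into KB4, sending ⟨a⟩φ to ¬K_a¬⊤ ∧ s φ and ◇_aΦ to ¬K_a¬(u Φ).  Every s φ is a-local
-- (X → K_a X and ¬X → K_a ¬X, by the axiom 5 that B and 4 derive), which is what makes the
-- adjunction rules valid under the back-translation; thus ⊢_e Φ gives ⊢ u Φ and ⊢_a φ gives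
-- ⊢ ¬K_a¬⊤ → s φ.  Finally u (t Φ) is KB4-equivalent to Φ, because ¬K_a¬⊤ → K_a X is
-- equivalent to K_a X: where ¬K_a¬⊤ fails, K_a holds vacuously.

module Submission where

open import Defs
open import Data.Bool using (Bool; true; false; T; not; _∧_)
open import Data.Bool.Properties using (T-∧; T-≡)
open import Data.Fin using (Fin)
open import Data.List using (List; []; _∷_; foldr; map; allFin)
open import Data.Nat using (ℕ; zero; suc; _<_; _⊔_; s≤s)
open import Data.Nat.Properties using (≤-refl; m<n⇒m<n⊔o; m<n⇒m<o⊔n)
open import Data.Product using (_,_; _×_; proj₁; proj₂)
open import Function using (_∘_)
open import Function.Bundles using (Equivalence; _⇔_; mk⇔)
open import Relation.Binary.PropositionalEquality using (_≡_; refl; sym; trans; cong; cong₂; module ≡-Reasoning)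

width : PForm → ℕ
width (var i)    = suc i
width pfalse     = zero
width (pneg P)   = width P
width (pand P Q) = width P ⊔ width Q

evalP-cong : ∀ {v w} P → (∀ {i} → i < width P → v i ≡ w i) → evalP v P ≡ evalP w P
evalP-cong (var i)    v≗w = v≗w ≤-refl
evalP-cong pfalse     v≗w = refl
evalP-cong (pneg P)   v≗w = cong not (evalP-cong P v≗w)
evalP-cong (pand P Q) v≗w =
  cong₂ _∧_ (evalP-cong P (λ i<w → v≗w (m<n⇒m<n⊔o (width Q) i<w)))
            (evalP-cong Q (λ i<w → v≗w (m<n⇒m<o⊔n (width P) i<w)))

fromList : List Bool → ℕ → Bool
fromList []       _       = false
fromList (b ∷ bs) zero    = b
fromList (b ∷ bs) (suc i) = fromList bs i

restrict : ℕ → (ℕ → Bool) → List Bool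
restrict zero    v = []
restrict (suc k) v = v 0 ∷ restrict k (v ∘ suc)

fromList-restrict : ∀ {k} v {i} → i < k → fromList (restrict k v) i ≡ v i
fromList-restrict v {zero}  (s≤s _)   = refl
fromList-restrict v {suc i} (s≤s i<k) = fromList-restrict (v ∘ suc) i<k

everyBoolList : ℕ → (List Bool → Bool) → Bool
everyBoolList zero    f = f []
everyBoolList (suc k) f = everyBoolList k (f ∘ (true ∷_)) ∧ everyBoolList k (f ∘ (false ∷_))

everyBoolList-restrict : ∀ k f v → T (everyBoolList k f) → T (f (restrict k v))
everyBoolList-restrict zero    f v h = h
everyBoolList-restrict (suc k) f v h with v 0
... | true  = everyBoolList-restrict k (f ∘ (true ∷_))  (v ∘ suc) (proj₁ (Equivalence.to T-∧ h))
... | false = everyBoolList-restrict k (f ∘ (false ∷_)) (v ∘ suc) (proj₂ (Equivalence.to T-∧ h))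

isTautology : PForm → Bool
isTautology P = everyBoolList (width P) (λ bs → evalP (fromList bs) P)

isTautology-sound : ∀ P → T (isTautology P) → Tautology P
isTautology-sound P h v = begin
  evalP v P                                  ≡⟨ evalP-cong P (λ i<w → sym (fromList-restrict v i<w)) ⟩
  evalP (fromList (restrict (width P) v)) P  ≡⟨ Equivalence.to T-≡ (everyBoolList-restrict (width P) _ v h) ⟩
  true                                       ∎
  where open ≡-Reasoning

infixr 4 _⟹_
infixr 6 _&_
infix  8 ~_

~_ : PForm → PForm
~_ = pneg

_&_ : PForm → PForm → PForm
_&_ = pand

_⟹_ : PForm → PForm → PForm
P ⟹ Q = ~ (P & ~ Q)

p₀ p₁ p₂ p₃ : PForm
p₀ = var 0
p₁ = var 1
p₂ = var 2
p₃ = var 3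

TautInstance-map : {F G : Set} {⊥F : F} {¬F : F → F} {∧F : F → F → F}
  {⊥G : G} {¬G : G → G} {∧G : G → G → G} (f : F → G) → f ⊥F ≡ ⊥G →
  (∀ x → f (¬F x) ≡ ¬G (f x)) → (∀ x y → f (∧F x y) ≡ ∧G (f x) (f y)) →
  ∀ {φ} → TautInstance ⊥F ¬F ∧F φ → TautInstance ⊥G ¬G ∧G (f φ)
TautInstance-map {⊥F = ⊥F} {¬F} {∧F} {⊥G} {¬G} {∧G} f f-⊥ f-¬ f-∧ (P , σ , P-taut , refl) =
  P , f ∘ σ , P-taut , sym (instP-map P)
  where
  instP-map : ∀ P → f (instP ⊥F ¬F ∧F σ P) ≡ instP ⊥G ¬G ∧G (f ∘ σ) P
  instP-map (var i)    = refl
  instP-map pfalse     = f-⊥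
  instP-map (pneg P)   = trans (f-¬ _) (cong ¬G (instP-map P))
  instP-map (pand P Q) = trans (f-∧ _ _) (cong₂ ∧G (instP-map P) (instP-map Q))

module HilbertCalculus {F : Set} (⊥′ : F) (¬′_ : F → F) (_∧′_ : F → F → F) (⊢_ : F → Set)
  (taut : ∀ {φ} → TautInstance ⊥′ ¬′_ _∧′_ φ → ⊢ φ)
  (mp : ∀ {φ ψ} → ⊢ ¬′ (φ ∧′ (¬′ ψ)) → ⊢ φ → ⊢ ψ) where

  infixr 4 _⇒_
  infixr 5 _⨾_
  infix  3 _≈_

  _⇒_ : F → F → F
  A ⇒ B = ¬′ (A ∧′ (¬′ B))

  _∨_ : F → F → F
  A ∨ B = ¬′ ((¬′ A) ∧′ (¬′ B))

  assignment : List F → ℕ → F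
  assignment []       _       = ⊥′
  assignment (A ∷ As) zero    = A
  assignment (A ∷ As) (suc i) = assignment As i

  by-tautology : (P : PForm) {_ : T (isTautology P)} (As : List F) →
               ⊢ instP ⊥′ ¬′_ _∧′_ (assignment As) P
  by-tautology P {P-taut} As = taut (P , assignment As , isTautology-sound P P-taut , refl)

  ⇒-refl : ∀ {A} → ⊢ (A ⇒ A)
  ⇒-refl {A} = by-tautology (p₀ ⟹ p₀) (A ∷ [])

  ⇒-const : ∀ {A B} → ⊢ (A ⇒ B ⇒ A)
  ⇒-const {A} {B} = by-tautology (p₀ ⟹ p₁ ⟹ p₀) (A ∷ B ∷ [])

  weaken : ∀ {A B} → ⊢ B → ⊢ (A ⇒ B)
  weaken = mp ⇒-const

  ⇒-trans : ∀ {A B C} → ⊢ (A ⇒ B) → ⊢ (B ⇒ C) → ⊢ (A ⇒ C)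
  ⇒-trans {A} {B} {C} h k =
    mp (mp (by-tautology ((p₀ ⟹ p₁) ⟹ (p₁ ⟹ p₂) ⟹ p₀ ⟹ p₂) (A ∷ B ∷ C ∷ [])) h) k

  _⨾_ : ∀ {A B C} → ⊢ (A ⇒ B) → ⊢ (B ⇒ C) → ⊢ (A ⇒ C)
  _⨾_ = ⇒-trans

  ⇒-monoʳ : ∀ {A B C} → ⊢ (B ⇒ C) → ⊢ ((A ⇒ B) ⇒ (A ⇒ C))
  ⇒-monoʳ {A} {B} {C} = mp (by-tautology ((p₁ ⟹ p₂) ⟹ (p₀ ⟹ p₁) ⟹ (p₀ ⟹ p₂)) (A ∷ B ∷ C ∷ []))

  contraposition : ∀ {A B} → ⊢ ((A ⇒ B) ⇒ (¬′ B ⇒ ¬′ A))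
  contraposition {A} {B} = by-tautology ((p₀ ⟹ p₁) ⟹ (~ p₁ ⟹ ~ p₀)) (A ∷ B ∷ [])

  contrapose : ∀ {A B} → ⊢ (A ⇒ B) → ⊢ (¬′ B ⇒ ¬′ A)
  contrapose = mp contraposition

  ¬¬-intro : ∀ {A} → ⊢ (A ⇒ ¬′ ¬′ A)
  ¬¬-intro {A} = by-tautology (p₀ ⟹ ~ ~ p₀) (A ∷ [])

  ¬¬-elim : ∀ {A} → ⊢ (¬′ ¬′ A ⇒ A)
  ¬¬-elim {A} = by-tautology (~ ~ p₀ ⟹ p₀) (A ∷ [])

  ⊥-elim : ∀ {A} → ⊢ (⊥′ ⇒ A)
  ⊥-elim {A} = by-tautology (pfalse ⟹ p₀) (A ∷ [])

  ⊤-intro : ⊢ (¬′ ⊥′)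
  ⊤-intro = by-tautology (~ pfalse) []

  ⇒⊤ : ∀ {A} → ⊢ (A ⇒ ¬′ ⊥′)
  ⇒⊤ {A} = by-tautology (p₀ ⟹ ~ pfalse) (A ∷ [])

  ∧-elimˡ : ∀ {A B} → ⊢ (A ∧′ B ⇒ A)
  ∧-elimˡ {A} {B} = by-tautology (p₀ & p₁ ⟹ p₀) (A ∷ B ∷ [])

  ∧-elimʳ : ∀ {A B} → ⊢ (A ∧′ B ⇒ B)
  ∧-elimʳ {A} {B} = by-tautology (p₀ & p₁ ⟹ p₁) (A ∷ B ∷ [])

  pair : ∀ {A B} → ⊢ (A ⇒ B ⇒ A ∧′ B)
  pair {A} {B} = by-tautology (p₀ ⟹ p₁ ⟹ p₀ & p₁) (A ∷ B ∷ [])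

  ∧-intro : ∀ {A B C} → ⊢ (A ⇒ B) → ⊢ (A ⇒ C) → ⊢ (A ⇒ B ∧′ C)
  ∧-intro {A} {B} {C} h k =
    mp (mp (by-tautology ((p₀ ⟹ p₁) ⟹ (p₀ ⟹ p₂) ⟹ p₀ ⟹ p₁ & p₂) (A ∷ B ∷ C ∷ [])) h) k

  ∧-mono : ∀ {A B C D} → ⊢ (A ⇒ C) → ⊢ (B ⇒ D) → ⊢ (A ∧′ B ⇒ C ∧′ D)
  ∧-mono {A} {B} {C} {D} h k =
    mp (mp (by-tautology ((p₀ ⟹ p₂) ⟹ (p₁ ⟹ p₃) ⟹ p₀ & p₁ ⟹ p₂ & p₃) (A ∷ B ∷ C ∷ D ∷ [])) h) k

  ∨-mono : ∀ {A B C D} → ⊢ (A ⇒ C) → ⊢ (B ⇒ D) → ⊢ (A ∨ B ⇒ C ∨ D)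
  ∨-mono {A} {B} {C} {D} h k =
    mp (mp (by-tautology ((p₀ ⟹ p₂) ⟹ (p₁ ⟹ p₃) ⟹ ~ (~ p₀ & ~ p₁) ⟹ ~ (~ p₂ & ~ p₃))
                         (A ∷ B ∷ C ∷ D ∷ [])) h) k

  ¬∧-introˡ : ∀ {A B} → ⊢ (¬′ A ⇒ ¬′ (A ∧′ B))
  ¬∧-introˡ {A} {B} = by-tautology (~ p₀ ⟹ ~ (p₀ & p₁)) (A ∷ B ∷ [])

  ¬∧-introʳ : ∀ {A B} → ⊢ (¬′ B ⇒ ¬′ (A ∧′ B))
  ¬∧-introʳ {A} {B} = by-tautology (~ p₁ ⟹ ~ (p₀ & p₁)) (A ∷ B ∷ [])

  ¬∧-elim : ∀ {A B C} → ⊢ (¬′ A ⇒ C) → ⊢ (¬′ B ⇒ C) → ⊢ (¬′ (A ∧′ B) ⇒ C)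
  ¬∧-elim {A} {B} {C} h k =
    mp (mp (by-tautology ((~ p₀ ⟹ p₂) ⟹ (~ p₁ ⟹ p₂) ⟹ ~ (p₀ & p₁) ⟹ p₂) (A ∷ B ∷ C ∷ [])) h) k

  modus-ponens : ∀ {A B} → ⊢ ((A ⇒ B) ∧′ A ⇒ B)
  modus-ponens {A} {B} = by-tautology ((p₀ ⟹ p₁) & p₀ ⟹ p₁) (A ∷ B ∷ [])

  curry : ∀ {A B C} → ⊢ (A ∧′ B ⇒ C) → ⊢ (A ⇒ B ⇒ C)
  curry {A} {B} {C} = mp (by-tautology ((p₀ & p₁ ⟹ p₂) ⟹ p₀ ⟹ p₁ ⟹ p₂) (A ∷ B ∷ C ∷ []))

  uncurry : ∀ {A B C} → ⊢ (A ⇒ B ⇒ C) → ⊢ (A ∧′ B ⇒ C)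
  uncurry {A} {B} {C} = mp (by-tautology ((p₀ ⟹ p₁ ⟹ p₂) ⟹ p₀ & p₁ ⟹ p₂) (A ∷ B ∷ C ∷ []))

  flip : ∀ {A B C} → ⊢ (A ⇒ B ⇒ C) → ⊢ (B ⇒ A ⇒ C)
  flip {A} {B} {C} = mp (by-tautology ((p₀ ⟹ p₁ ⟹ p₂) ⟹ p₁ ⟹ p₀ ⟹ p₂) (A ∷ B ∷ C ∷ []))

  ⇒-distrib : ∀ {A B C} → ⊢ (A ⇒ B ⇒ C) → ⊢ ((A ⇒ B) ⇒ (A ⇒ C))
  ⇒-distrib {A} {B} {C} = mp (by-tautology ((p₀ ⟹ p₁ ⟹ p₂) ⟹ (p₀ ⟹ p₁) ⟹ p₀ ⟹ p₂) (A ∷ B ∷ C ∷ []))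

  mp-under : ∀ {A B C} → ⊢ (A ⇒ B ⇒ C) → ⊢ (A ⇒ B) → ⊢ (A ⇒ C)
  mp-under h = mp (⇒-distrib h)

  ∧-strengthen : ∀ {A B C} → ⊢ (A ⇒ B ⇒ C) → ⊢ (A ∧′ B ⇒ A ∧′ C)
  ∧-strengthen h = ∧-intro ∧-elimˡ (uncurry h)

  _≈_ : F → F → Set
  A ≈ B = ⊢ (A ⇒ B) × ⊢ (B ⇒ A)

  ≈-refl : ∀ {A} → A ≈ A
  ≈-refl = ⇒-refl , ⇒-refl

  ≈-trans : ∀ {A B C} → A ≈ B → B ≈ C → A ≈ C
  ≈-trans (f , g) (f′ , g′) = f ⨾ f′ , g′ ⨾ g

  ¬-cong : ∀ {A B} → A ≈ B → ¬′ A ≈ ¬′ B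
  ¬-cong (f , g) = contrapose g , contrapose f

  ∧-cong : ∀ {A B C D} → A ≈ C → B ≈ D → A ∧′ B ≈ C ∧′ D
  ∧-cong (f , g) (f′ , g′) = ∧-mono f f′ , ∧-mono g g′

  ⇒-congʳ : ∀ {A B C} → B ≈ C → (A ⇒ B) ≈ (A ⇒ C)
  ⇒-congʳ (f , g) = ⇒-monoʳ f , ⇒-monoʳ g

  ⇒-absorbed : ∀ {A B} → ⊢ (¬′ A ⇒ B) → (A ⇒ B) ≈ B
  ⇒-absorbed {A} {B} h =
    mp (by-tautology ((~ p₀ ⟹ p₁) ⟹ (p₀ ⟹ p₁) ⟹ p₁) (A ∷ B ∷ [])) h , ⇒-const

module Soundness (n : ℕ) (APa : Fin n → Set) (APe : Set) where

  open Logic n APa APe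

  module World = HilbertCalculus ⊥e ¬e_ _∧e_ ⊢e tautE mpE
  module Agent (a : Fin n) = HilbertCalculus {AForm a} ⊥a ¬a_ _∧a_ (⊢a a) tautA mpA

  ⟨⟩□-elim : ∀ {a A} → ⊢e ((⟨ a ⟩ □ A) ⇒e A)
  ⟨⟩□-elim {a} = adj2' (Agent.⇒-refl a)

  ◇[]-elim : ∀ {a φ} → ⊢a a (◇ ([ a ] φ) ⇒a φ)
  ◇[]-elim = adj1 World.⇒-refl

  □-∧ : ∀ {a A B} → ⊢a a ((□ A ∧a □ B) ⇒a □ (A ∧e B))
  □-∧ {a} = adj2 (World.∧-intro (World.⇒-trans (mono⟨⟩ (Agent.∧-elimˡ a)) ⟨⟩□-elim)
                                (World.⇒-trans (mono⟨⟩ (Agent.∧-elimʳ a)) ⟨⟩□-elim))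

  []-∧ : ∀ {a φ ψ} → ⊢e ((([ a ] φ) ∧e ([ a ] ψ)) ⇒e ([ a ] (φ ∧a ψ)))
  []-∧ {a} = adj1' (Agent.∧-intro a (Agent.⇒-trans a (mono◇ World.∧-elimˡ) ◇[]-elim)
                                    (Agent.⇒-trans a (mono◇ World.∧-elimʳ) ◇[]-elim))

  []□-K : ∀ {a A B} → ⊢e (([ a ] □ (A ⇒e B)) ⇒e (([ a ] □ A) ⇒e ([ a ] □ B)))
  []□-K {a} =
    World.curry (World.⇒-trans []-∧ (mono[] (Agent.⇒-trans a □-∧ (mono□ World.modus-ponens))))

  []□-B : ∀ {a A} → ⊢e (A ⇒e ([ a ] □ (¬e ([ a ] □ (¬e A)))))
  []□-B {a} = adj1' (adj2 (World.⇒-trans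
    (mono⟨⟩ (Agent.⇒-trans a (mono◇ World.¬¬-intro) (Agent.¬¬-intro a))) World.¬¬-intro))

  []□-4 : ∀ {a A} → ⊢e (([ a ] □ A) ⇒e ([ a ] □ ([ a ] □ A)))
  []□-4 {a} = adj1' (Agent.⇒-trans a ◇[]-elim (adj2 (adj1' counit)))

  ⟨⟩⊤⇒t¬K⊥ : ∀ {a} → ⊢e ((⟨ a ⟩ ⊤a) ⇒e t (¬k K a ⊥k))
  ⟨⟩⊤⇒t¬K⊥ {a} =
    World.⇒-trans (mono⟨⟩ (Agent.⇒-trans a (Agent.⇒-trans a unit (mono◇ World.⇒⊤)) (Agent.¬¬-intro a)))
                  World.¬¬-intro

  t-NE : ⊢e (NEe ⇒e t NEk)
  t-NE = go (allFin n)
    where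
    go : ∀ as → ⊢e (foldr _∨e_ ⊥e (map (λ a → ⟨ a ⟩ ⊤a) as) ⇒e
                    t (foldr _∨k_ ⊥k (map (λ a → ¬k K a ⊥k) as)))
    go []       = World.⇒-refl
    go (a ∷ as) = World.∨-mono ⟨⟩⊤⇒t¬K⊥ (go as)

  soundness : ∀ {Φ} → ⊢KB4NE Φ → ⊢e (t Φ)
  soundness (taut i) = tautE (TautInstance-map t refl (λ _ → refl) (λ _ _ → refl) i)
  soundness (mp p q) = mpE (soundness p) (soundness q)
  soundness (nec p)  = nec[] (nec□ (soundness p))
  soundness axK      = []□-K
  soundness axB      = []□-B
  soundness ax4      = []□-4
  soundness axNE     = mpE t-NE axNEe

module Completeness (n : ℕ) (APa : Fin n → Set) (APe : Set) where

  open Logic n APa APe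
  open HilbertCalculus ⊥k ¬k_ _∧k_ ⊢KB4NE taut mp

  M : Fin n → Fm → Fm
  M a A = ¬k K a (¬k A)

  K-mono : ∀ {a A B} → ⊢KB4NE (A ⇒k B) → ⊢KB4NE (K a A ⇒k K a B)
  K-mono h = mp axK (nec h)

  K-cong : ∀ {a A B} → A ≈ B → K a A ≈ K a B
  K-cong (f , g) = K-mono f , K-mono g

  K-∧ : ∀ {a A B} → ⊢KB4NE ((K a A ∧k K a B) ⇒k K a (A ∧k B))
  K-∧ = uncurry (K-mono pair ⨾ axK)

  M-mono : ∀ {a A B} → ⊢KB4NE (A ⇒k B) → ⊢KB4NE (M a A ⇒k M a B)
  M-mono h = contrapose (K-mono (contrapose h))

  K-M : ∀ {a A B} → ⊢KB4NE (K a (A ⇒k B) ⇒k (M a A ⇒k M a B))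
  K-M = K-mono contraposition ⨾ axK ⨾ contraposition

  K-M-∧ : ∀ {a A B} → ⊢KB4NE (K a B ⇒k (M a A ⇒k M a (B ∧k A)))
  K-M-∧ = K-mono pair ⨾ K-M

  M-K-elim : ∀ {a A} → ⊢KB4NE (M a (K a A) ⇒k A)
  M-K-elim = contrapose (axB ⨾ K-mono (contrapose (K-mono ¬¬-intro))) ⨾ ¬¬-elim

  M-M : ∀ {a A} → ⊢KB4NE (M a (M a A) ⇒k M a A)
  M-M = contrapose (K-mono ¬¬-intro) ⨾ contrapose ax4

  axiom5 : ∀ {a A} → ⊢KB4NE (M a A ⇒k K a (M a A))
  axiom5 = axB ⨾ K-mono M-M

  ¬M⇒K¬M : ∀ {a A} → ⊢KB4NE ((¬k M a A) ⇒k K a (¬k M a A))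
  ¬M⇒K¬M = ¬¬-elim ⨾ ax4 ⨾ K-mono ¬¬-intro

  active : Fin n → Fm
  active a = M a (¬k ⊥k)

  K-active : ∀ {a} → ⊢KB4NE (K a (active a))
  K-active = mp axB ⊤-intro

  K-active-∧ : ∀ {a A} → ⊢KB4NE (K a A ⇒k K a (active a ∧k A))
  K-active-∧ = ∧-intro (weaken K-active) ⇒-refl ⨾ K-∧

  M-active-∧ : ∀ {a A} → ⊢KB4NE (M a A ⇒k M a (active a ∧k A))
  M-active-∧ = mp K-M-∧ K-active

  active-D : ∀ {a A} → ⊢KB4NE ((active a ∧k K a A) ⇒k M a A)
  active-D = uncurry (flip (K-mono ⇒-const ⨾ K-M))

  active-T : ∀ {a A} → ⊢KB4NE ((active a ∧k K a A) ⇒k A)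
  active-T = ∧-mono ⇒-refl ax4 ⨾ active-D ⨾ M-K-elim

  inactive-K : ∀ {a A} → ⊢KB4NE ((¬k active a) ⇒k K a A)
  inactive-K = ¬¬-elim ⨾ K-mono (¬¬-elim ⨾ ⊥-elim)

  ¬K⊥⇒active : ∀ {a} → ⊢KB4NE ((¬k K a ⊥k) ⇒k active a)
  ¬K⊥⇒active = contrapose (K-mono ¬¬-elim)

  record Local (a : Fin n) (X : Fm) : Set where
    field
      K-intro  : ⊢KB4NE (X ⇒k K a X)
      K-intro¬ : ⊢KB4NE ((¬k X) ⇒k K a (¬k X))

    M-elim : ⊢KB4NE (M a X ⇒k X)
    M-elim = contrapose K-intro¬ ⨾ ¬¬-elim

  open Local

  Local-⊥ : ∀ {a} → Local a ⊥k
  Local-⊥ = record { K-intro = ⊥-elim ; K-intro¬ = weaken (nec ⊤-intro) }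

  Local-¬ : ∀ {a X} → Local a X → Local a (¬k X)
  Local-¬ X-local = record
    { K-intro  = K-intro¬ X-local
    ; K-intro¬ = ¬¬-elim ⨾ K-intro X-local ⨾ K-mono ¬¬-intro
    }

  Local-∧ : ∀ {a X Y} → Local a X → Local a Y → Local a (X ∧k Y)
  Local-∧ X-local Y-local = record
    { K-intro  = ∧-mono (K-intro X-local) (K-intro Y-local) ⨾ K-∧
    ; K-intro¬ = ¬∧-elim (K-intro¬ X-local ⨾ K-mono ¬∧-introˡ)
                         (K-intro¬ Y-local ⨾ K-mono ¬∧-introʳ)
    }

  Local-M : ∀ {a X} → Local a (M a X)
  Local-M = record { K-intro = axiom5 ; K-intro¬ = ¬M⇒K¬M }

  mutual
    s : ∀ {a} → AForm a → Fm
    s (pa x)   = ⊥k -- any a-local formula would do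
    s ⊥a       = ⊥k
    s (¬a φ)   = ¬k s φ
    s (φ ∧a ψ) = s φ ∧k s ψ
    s {a} (◇ Φ) = M a (u Φ)

    u : WForm → Fm
    u (pe p)    = atom p
    u ⊥e        = ⊥k
    u (¬e Φ)    = ¬k u Φ
    u (Φ ∧e Ψ)  = u Φ ∧k u Ψ
    u (⟨ a ⟩ φ) = active a ∧k s φ

  Local-s : ∀ {a} (φ : AForm a) → Local a (s φ)
  Local-s (pa x)   = Local-⊥
  Local-s ⊥a       = Local-⊥
  Local-s (¬a φ)   = Local-¬ (Local-s φ)
  Local-s (φ ∧a ψ) = Local-∧ (Local-s φ) (Local-s ψ)
  Local-s (◇ Φ)    = Local-M

  s-□ : ∀ {a Φ} → s {a} (□ Φ) ≈ K a (u Φ)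
  s-□ = ¬¬-elim ⨾ K-mono ¬¬-elim , K-mono ¬¬-intro ⨾ ¬¬-intro

  u-NE : ⊢KB4NE (NEk ⇒k u NEe)
  u-NE = go (allFin n)
    where
    go : ∀ as → ⊢KB4NE (foldr _∨k_ ⊥k (map (λ a → ¬k K a ⊥k) as) ⇒k
                        u (foldr _∨e_ ⊥e (map (λ a → ⟨ a ⟩ ⊤a) as)))
    go []       = ⇒-refl
    go (a ∷ as) = ∨-mono (∧-intro ¬K⊥⇒active ⇒⊤) (go as)

  mutual
    completenessₐ : ∀ {a φ} → ⊢a a φ → ⊢KB4NE (active a ⇒k s φ)
    completenessₐ {a} (tautA i) =
      weaken (taut (TautInstance-map (s {a}) refl (λ _ → refl) (λ _ _ → refl) i))
    completenessₐ (mpA p q)     = mp-under (completenessₐ p) (completenessₐ q)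
    completenessₐ (nec□ p)      = weaken (mp (proj₂ s-□) (nec (completenessₑ p)))
    completenessₐ (mono◇ p)     = weaken (M-mono (completenessₑ p))
    completenessₐ (mono□ p)     = weaken (contrapose (M-mono (contrapose (completenessₑ p))))
    completenessₐ (adj1 {ψ = ψ} p) =
      weaken (M-active-∧ ⨾ M-mono (uncurry (flip (completenessₑ p))) ⨾ M-elim (Local-s ψ))
    completenessₐ (adj2 {φ = φ} p) =
      weaken (K-intro (Local-s φ) ⨾ K-active-∧ ⨾ K-mono (completenessₑ p) ⨾ proj₂ s-□)
    completenessₐ (unit {φ = φ}) =
      curry (∧-mono ⇒-refl (K-intro (Local-s φ)) ⨾ active-D ⨾ M-active-∧)
    completenessₐ (counit {φ = φ}) = weaken (M-mono ∧-elimʳ ⨾ M-elim (Local-s φ))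

    completenessₑ : ∀ {Φ} → ⊢e Φ → ⊢KB4NE (u Φ)
    completenessₑ (tautE i)  = taut (TautInstance-map u refl (λ _ → refl) (λ _ _ → refl) i)
    completenessₑ (mpE p q)  = mp (completenessₑ p) (completenessₑ q)
    completenessₑ (nec[] p)  = completenessₐ p
    completenessₑ (mono⟨⟩ p) = ∧-strengthen (completenessₐ p)
    completenessₑ (mono[] p) = ⇒-distrib (completenessₐ p)
    completenessₑ (adj1' p)  =
      axB ⨾ K-active-∧ ⨾ K-mono (uncurry (completenessₐ p)) ⨾ flip (curry active-T)
    completenessₑ (adj2' p)  =
      ∧-strengthen (completenessₐ p) ⨾ ∧-mono ⇒-refl (proj₁ s-□) ⨾ active-T
    completenessₑ axNEe      = mp u-NE axNE

  u∘t≈id : ∀ Φ → u (t Φ) ≈ Φ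
  u∘t≈id (atom p) = ≈-refl
  u∘t≈id ⊥k       = ≈-refl
  u∘t≈id (¬k Φ)   = ¬-cong (u∘t≈id Φ)
  u∘t≈id (Φ ∧k Ψ) = ∧-cong (u∘t≈id Φ) (u∘t≈id Ψ)
  u∘t≈id (K a Φ)  =
    ≈-trans (⇒-congʳ (≈-trans s-□ (K-cong (u∘t≈id Φ)))) (⇒-absorbed inactive-K)

  completeness : ∀ {Φ} → ⊢e (t Φ) → ⊢KB4NE Φ
  completeness {Φ} p = mp (proj₁ (u∘t≈id Φ)) (completenessₑ p)

mainTheorem2 : (n : ℕ) (APa : Fin n → Set) (APe : Set) (Φ : Logic.Fm n APa APe) →
    Logic.⊢KB4NE n APa APe Φ ⇔ Logic.⊢e n APa APe (Logic.t n APa APe Φ)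
mainTheorem2 n APa APe Φ =
  mk⇔ (Soundness.soundness n APa APe) (Completeness.completeness n APa APe)
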